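{- Let $k\ge1$ be an integer and $\{U_n\}_{n\ge0}=\{U_n(k)\}$ defined by $U_0=0$, $U_1=1$, $U_{n+2}=(4k+2)U_{n+1}-U_n$. For a positive integer $m$ let $z(m)$ be the smallest $n\ge1$ with $m\mid U_n$. Let $p$ be an odd prime with $p\mid k$ and let $b\ge1$. Then for all integers $i,j\ge0$, $U_i\equiv U_j\pmod{p^b}$ if and only if $i\equiv j\pmod{z(p^b)}$. -}

module Defs where

open import Data.Nat as ℕ using (ℕ; zero; suc; _≤_)
open import Data.Integer as ℤ using (ℤ; +_; _-_)
open import Data.Integer.Divisibility using (_∣_)
open import Data.Product using (_×_)

U : ℕ → ℕ → ℤ
U k zero = + 0
U k (suc zero) = + 1
U k (suc (suc n)) = (+ (4 ℕ.* k ℕ.+ 2)) ℤ.* U k (suc n) - U k n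

_≡_[mod_] : ℤ → ℤ → ℕ → Set
a ≡ b [mod m ] = (+ m) ∣ (a - b)

IsZ : ℕ → ℕ → ℕ → Set
IsZ k m z = (1 ≤ z) × ((+ m) ∣ U k z) × (∀ n → 1 ≤ n → (+ m) ∣ U k n → z ≤ n)

module Submission where

-- Write A = 4k+2, m = p^b and Q(x,u) = x² − A·x·u + u².
--  * Every pair of consecutive terms satisfies the Cassini identity Q(U_{n+1},U_n) = 1.
--  * Since p ∣ k we have A ≡ 2 (mod p), hence U_n ≡ n (mod p).
--  * From (x − y)(x + y − A·v) = Q(x,u) − Q(y,v) + (u − v)(A·x − u − v): if Q(x,u) = Q(y,v),
--    u ≡ v (mod p^b) and p ∤ x + y − A·v, then x ≡ y (mod p^b).  Applied to consecutive
--    terms, where x + y − A·v ≡ ±2 (mod p) and p is odd, this shows that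
--    U_i ≡ U_j (mod m) holds iff U_{i+1} ≡ U_{j+1} (mod m).
--  * Consequently U_{j+d} ≡ U_j (mod m) iff m ∣ U_d, and the zero set {d | m ∣ U_d}
--    satisfies:  m ∣ U_d  ⇒  (m ∣ U_{d+e} ⇔ m ∣ U_e).  It is nonempty beyond 0 by the
--    pigeonhole principle, so it has a least positive element z = z(m), and such a set
--    consists exactly of the multiples of z.  The theorem follows by comparing i and j
--    through their difference.

open import Defs
open import Data.Nat using (ℕ; _≤_; _^_)
open import Data.Nat.Divisibility using (_∣_)
open import Data.Nat.Primality using (Prime)
open import Data.Integer using (+_)
open import Data.Product using (Σ; _×_)
open import Function.Bundles using (_⇔_)
open import Relation.Nullary using (¬_)

open import Data.Nat as ℕ using (zero; suc; _<_; _∸_; NonZero)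
import Data.Nat.Properties as ℕP
import Data.Nat.Divisibility as ℕD
open import Data.Nat.DivMod using (_%_; _/_; m≡m%n+[m/n]*n; m%n<n)
open import Data.Nat.Primality using (euclidsLemma; prime⇒nonZero; prime⇒irreducible; prime[2]; ¬prime[1])
open import Data.Integer using (ℤ; _+_; _-_; _*_; -_; ∣_∣)
import Data.Integer.Properties as ℤP
open import Data.Integer.Divisibility using () renaming (_∣_ to _∣ℤ_)
import Data.Integer.Divisibility.Signed as ℤˢ
open import Data.Integer.DivMod using (_%ℕ_; _/ℕ_; a≡a%ℕn+[a/ℕn]*n; n%ℕd<d)
open import Data.Integer.Tactic.RingSolver using (solve-∀)
import Data.Nat.Tactic.RingSolver as ℕ-Ring
open import Data.Fin using (Fin; toℕ; fromℕ<)
open import Data.Fin.Properties using (pigeonhole; toℕ-fromℕ<)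
open import Data.Product using (_,_; proj₁; proj₂; ∃; ∃₂)
open import Data.Sum using (_⊎_; inj₁; inj₂)
open import Function using (_∘_)
open import Function.Bundles using (mk⇔; Equivalence)
import Function.Properties.Equivalence as ⇔
open import Relation.Binary.Bundles using (Setoid)
open import Relation.Binary.Definitions using (Symmetric)
import Relation.Binary.Reasoning.Setoid as SetoidReasoning
open import Relation.Nullary using (yes; no; contradiction)
open import Relation.Nullary.Decidable using (_×-dec_)
open import Relation.Unary using (Decidable)
open import Relation.Binary.PropositionalEquality using (_≡_; refl; sym; trans; cong; cong₂; subst; module ≡-Reasoning)

open Equivalence using (to; from)

-- The congruence of Defs unfolds to a divisibility between absolute
-- values, whose arguments unification cannot recover; we therefore work with a record
-- wrapping signed divisibility (which also carries the ring lemmas) and convert at the end.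
infix 4 _≋_⟨mod_⟩
record _≋_⟨mod_⟩ (a b : ℤ) (m : ℕ) : Set where
  constructor mod-dvd
  field dvd : + m ℤˢ.∣ (a - b)
open _≋_⟨mod_⟩

≡[mod]⇔≋ : ∀ {m a b} → a ≡ b [mod m ] ⇔ a ≋ b ⟨mod m ⟩
≡[mod]⇔≋ = mk⇔ (mod-dvd ∘ ℤˢ.∣ᵤ⇒∣) (ℤˢ.∣⇒∣ᵤ ∘ dvd)

module _ {m : ℕ} where

  mod-intro : ∀ {a b} c → + m ℤˢ.∣ c → a - b ≡ c → a ≋ b ⟨mod m ⟩
  mod-intro c m∣c a-b≡c = mod-dvd (subst (+ m ℤˢ.∣_) (sym a-b≡c) m∣c)

  mod-refl : ∀ {a} → a ≋ a ⟨mod m ⟩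
  mod-refl {a} = mod-intro (+ 0) (ℤˢ.divides (+ 0) refl) (ℤP.+-inverseʳ a)

  mod-sym : ∀ {a b} → a ≋ b ⟨mod m ⟩ → b ≋ a ⟨mod m ⟩
  mod-sym {a} {b} (mod-dvd m∣a-b) = mod-intro _ (ℤˢ.∣m⇒∣-m m∣a-b) (swap a b)
    where
    swap : ∀ a b → b - a ≡ - (a - b)
    swap = solve-∀

  mod-trans : ∀ {a b c} → a ≋ b ⟨mod m ⟩ → b ≋ c ⟨mod m ⟩ → a ≋ c ⟨mod m ⟩
  mod-trans {a} {b} {c} (mod-dvd m∣a-b) (mod-dvd m∣b-c) =
    mod-intro _ (ℤˢ.∣m∣n⇒∣m+n m∣a-b m∣b-c) (telescope a b c)
    where
    telescope : ∀ a b c → a - c ≡ (a - b) + (b - c)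
    telescope = solve-∀

  mod-+ : ∀ {a b c d} → a ≋ b ⟨mod m ⟩ → c ≋ d ⟨mod m ⟩ → a + c ≋ b + d ⟨mod m ⟩
  mod-+ {a} {b} {c} {d} (mod-dvd m∣a-b) (mod-dvd m∣c-d) =
    mod-intro _ (ℤˢ.∣m∣n⇒∣m+n m∣a-b m∣c-d) (regroup a b c d)
    where
    regroup : ∀ a b c d → (a + c) - (b + d) ≡ (a - b) + (c - d)
    regroup = solve-∀

  mod-- : ∀ {a b c d} → a ≋ b ⟨mod m ⟩ → c ≋ d ⟨mod m ⟩ → a - c ≋ b - d ⟨mod m ⟩
  mod-- {a} {b} {c} {d} (mod-dvd m∣a-b) (mod-dvd m∣c-d) =
    mod-intro _ (ℤˢ.∣m∣n⇒∣m-n m∣a-b m∣c-d) (regroup a b c d)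
    where
    regroup : ∀ a b c d → (a - c) - (b - d) ≡ (a - b) - (c - d)
    regroup = solve-∀

  mod-* : ∀ {a b c d} → a ≋ b ⟨mod m ⟩ → c ≋ d ⟨mod m ⟩ → a * c ≋ b * d ⟨mod m ⟩
  mod-* {a} {b} {c} {d} (mod-dvd m∣a-b) (mod-dvd m∣c-d) =
    mod-intro _ (ℤˢ.∣m∣n⇒∣m+n (ℤˢ.∣m⇒∣m*n c m∣a-b) (ℤˢ.∣n⇒∣m*n b m∣c-d)) (regroup a b c d)
    where
    regroup : ∀ a b c d → a * c - b * d ≡ (a - b) * c + b * (c - d)
    regroup = solve-∀

  ∣⇔≋0 : ∀ {a} → + m ∣ℤ a ⇔ a ≋ + 0 ⟨mod m ⟩
  ∣⇔≋0 {a} = mk⇔ (λ m∣a → mod-intro a (ℤˢ.∣ᵤ⇒∣ m∣a) a-0≡a)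
                 (λ a≋0 → ℤˢ.∣⇒∣ᵤ (subst (+ m ℤˢ.∣_) a-0≡a (dvd a≋0)))
    where
    a-0≡a : a - + 0 ≡ a
    a-0≡a = ℤP.+-identityʳ a

  mod-retarget : ∀ {a b c} → b ≋ c ⟨mod m ⟩ → a ≋ b ⟨mod m ⟩ ⇔ a ≋ c ⟨mod m ⟩
  mod-retarget b≋c = mk⇔ (λ a≋b → mod-trans a≋b b≋c) (λ a≋c → mod-trans a≋c (mod-sym b≋c))

mod-weaken : ∀ {n m a b} → n ∣ m → a ≋ b ⟨mod m ⟩ → a ≋ b ⟨mod n ⟩
mod-weaken n∣m (mod-dvd m∣a-b) = mod-dvd (ℤˢ.∣-trans (ℤˢ.∣ᵤ⇒∣ n∣m) m∣a-b)

mod-not-dvd : ∀ {n w c} → w ≋ c ⟨mod n ⟩ → ¬ (+ n ∣ℤ c) → ¬ (+ n ∣ℤ w)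
mod-not-dvd w≋c n∤c n∣w = n∤c (from ∣⇔≋0 (mod-trans (mod-sym w≋c) (to ∣⇔≋0 n∣w)))

modSetoid : ℕ → Setoid _ _
modSetoid m = record
  { Carrier = ℤ
  ; _≈_ = _≋_⟨mod m ⟩
  ; isEquivalence = record { refl = mod-refl ; sym = mod-sym ; trans = mod-trans }
  }

module ModReasoning (m : ℕ) = SetoidReasoning (modSetoid m)

prime-power-cancel : ∀ {p w} → Prime p → ¬ p ∣ w → ∀ b {x} → p ^ b ∣ x ℕ.* w → p ^ b ∣ x
prime-power-cancel _ _ zero _ = ℕD.1∣ _
prime-power-cancel {p} {w} p-prime p∤w (suc b) {x} pᵇ⁺¹∣xw
  with euclidsLemma x w p-prime (ℕD.∣-trans (ℕD.m∣m*n (p ^ b)) pᵇ⁺¹∣xw)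
... | inj₂ p∣w = contradiction p∣w p∤w
... | inj₁ (ℕD.divides q refl) = subst (p ^ suc b ∣_) (ℕP.*-comm p q) (ℕD.*-monoʳ-∣ p pᵇ∣q)
  where
  instance
    p≢0 : NonZero p
    p≢0 = prime⇒nonZero p-prime
  regroup : ∀ q p w → q ℕ.* p ℕ.* w ≡ p ℕ.* (q ℕ.* w)
  regroup = ℕ-Ring.solve-∀
  pᵇ∣q : p ^ b ∣ q
  pᵇ∣q = prime-power-cancel p-prime p∤w b (ℕD.*-cancelˡ-∣ p (subst (p ^ suc b ∣_) (regroup q p w) pᵇ⁺¹∣xw))

prime-power-cancelℤ : ∀ {p w c} → Prime p → ¬ (+ p ∣ℤ w) → ∀ b → + (p ^ b) ∣ℤ (c * w) → + (p ^ b) ∣ℤ c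
prime-power-cancelℤ {p} {w} {c} p-prime p∤w b pᵇ∣cw =
  prime-power-cancel p-prime p∤w b (subst (p ^ b ∣_) (ℤP.abs-* c w) pᵇ∣cw)

odd-prime∤2 : ∀ {p} → Prime p → ¬ 2 ∣ p → ¬ p ∣ 2
odd-prime∤2 p-prime 2∤p p∣2 with prime⇒irreducible prime[2] p∣2
... | inj₁ refl = ¬prime[1] p-prime
... | inj₂ refl = 2∤p ℕD.∣-refl

IsLeastPositive : (ℕ → Set) → ℕ → Set
IsLeastPositive P z = 1 ≤ z × P z × (∀ n → 1 ≤ n → P n → z ≤ n)

least-element : ∀ {P : ℕ → Set} → Decidable P → ∀ {n} → P n → Σ ℕ (λ z → P z × (∀ k → P k → z ≤ k))
least-element {P} P? {n} Pn with below-or-least (suc n)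
  where
  below-or-least : ∀ N → (∀ k → P k → N ≤ k) ⊎ Σ ℕ (λ z → P z × (∀ k → P k → z ≤ k))
  below-or-least zero = inj₁ (λ _ _ → ℕ.z≤n)
  below-or-least (suc N) with below-or-least N
  ... | inj₂ least = inj₂ least
  ... | inj₁ N≤P with P? N
  ...   | yes PN = inj₂ (N , PN , N≤P)
  ...   | no ¬PN = inj₁ (λ k Pk → ℕP.≤∧≢⇒< (N≤P k Pk) (λ N≡k → ¬PN (subst P (sym N≡k) Pk)))
... | inj₁ n<P = contradiction (n<P n Pn) (ℕP.<-irrefl refl)
... | inj₂ least = least

module _ {P : ℕ → Set} where

  least-positive : Decidable P → (∃ λ n → 1 ≤ n × P n) → Σ ℕ (IsLeastPositive P)
  least-positive P? (n , n≥1 , Pn) with least-element positive? (n≥1 , Pn)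
    where
    positive? : Decidable (λ n → 1 ≤ n × P n)
    positive? n = (1 ℕ.≤? n) ×-dec P? n
  ... | z , (z≥1 , Pz) , z-least = z , z≥1 , Pz , λ k k≥1 Pk → z-least k (k≥1 , Pk)

  multiples-of-least : (∀ d e → P d → P (d ℕ.+ e) ⇔ P e) →
                       ∀ {z} → IsLeastPositive P z → ∀ d → P d ⇔ z ∣ d
  multiples-of-least shift {z} (z≥1 , Pz , z-least) d = mk⇔ divides multiple
    where
    instance
      z≢0 : NonZero z
      z≢0 = ℕ.>-nonZero z≥1
    multiple-q : ∀ q → P (q ℕ.* z)
    multiple-q zero = to (shift z 0 Pz) (subst P (sym (ℕP.+-identityʳ z)) Pz)
    multiple-q (suc q) = from (shift z (q ℕ.* z) Pz) (multiple-q q)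
    multiple : z ∣ d → P d
    multiple (ℕD.divides q refl) = multiple-q q
    -- the remainder of d modulo z lies in P, so it cannot be positive
    divides : P d → z ∣ d
    divides Pd with d % z in r≡d%z
    ... | zero = ℕD.m%n≡0⇒n∣m d z r≡d%z
    ... | suc r = contradiction (z-least (suc r) (ℕ.s≤s ℕ.z≤n) Pr) (ℕP.<⇒≱ r<z)
      where
      d≡qz+r : d ≡ (d / z) ℕ.* z ℕ.+ suc r
      d≡qz+r = trans (m≡m%n+[m/n]*n d z) (trans (cong (ℕ._+ (d / z) ℕ.* z) r≡d%z) (ℕP.+-comm (suc r) _))
      Pr : P (suc r)
      Pr = to (shift ((d / z) ℕ.* z) (suc r) (multiple-q (d / z))) (subst P d≡qz+r Pd)
      r<z : suc r < z
      r<z = subst (_< z) r≡d%z (m%n<n d z)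

same-residue : ∀ {m} .{{_ : NonZero m}} {x y} → x %ℕ m ≡ y %ℕ m → x ≋ y ⟨mod m ⟩
same-residue {m} {x} {y} same = mod-intro _ (ℤˢ.divides (x /ℕ m - y /ℕ m) refl) (begin
  x - y
    ≡⟨ cong₂ _-_ (a≡a%ℕn+[a/ℕn]*n x m) (a≡a%ℕn+[a/ℕn]*n y m) ⟩
  (+ (x %ℕ m) + x /ℕ m * + m) - (+ (y %ℕ m) + y /ℕ m * + m)
    ≡⟨ cong (λ r → (+ (x %ℕ m) + x /ℕ m * + m) - (+ r + y /ℕ m * + m)) (sym same) ⟩
  (+ (x %ℕ m) + x /ℕ m * + m) - (+ (x %ℕ m) + y /ℕ m * + m)
    ≡⟨ cancel (+ (x %ℕ m)) (x /ℕ m) (y /ℕ m) (+ m) ⟩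
  (x /ℕ m - y /ℕ m) * + m ∎)
  where
  open ≡-Reasoning
  cancel : ∀ r q q′ M → (r + q * M) - (r + q′ * M) ≡ (q - q′) * M
  cancel = solve-∀

pigeonhole-mod : ∀ m .{{_ : NonZero m}} (f : ℕ → ℤ) → ∃₂ λ i j → i < j × f i ≋ f j ⟨mod m ⟩
pigeonhole-mod m f with pigeonhole (ℕP.n<1+n m) residue
  where
  residue : Fin (suc m) → Fin m
  residue i = fromℕ< (n%ℕd<d (f (toℕ i)) m)
... | i , j , i<j , same =
  toℕ i , toℕ j , i<j , same-residue (trans (sym (toℕ-fromℕ< _)) (trans (cong toℕ same) (toℕ-fromℕ< _)))

compare-by-difference : ∀ {R S : ℕ → ℕ → Set} → Symmetric R → Symmetric S →
                        (∀ j d → R (j ℕ.+ d) j ⇔ S (j ℕ.+ d) j) → ∀ i j → R i j ⇔ S i j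
compare-by-difference {R} {S} R-sym S-sym on-difference i j with ℕP.≤-total j i
... | inj₁ j≤i = subst (λ i → R i j ⇔ S i j) (ℕP.m+[n∸m]≡n j≤i) (on-difference j (i ∸ j))
... | inj₂ i≤j = swap (subst (λ j → R j i ⇔ S j i) (ℕP.m+[n∸m]≡n i≤j) (on-difference i (j ∸ i)))
  where
  swap : R j i ⇔ S j i → R i j ⇔ S i j
  swap R⇔S = mk⇔ (S-sym ∘ to R⇔S ∘ R-sym) (R-sym ∘ from R⇔S ∘ S-sym)

index-difference : ∀ {z} j d → + (j ℕ.+ d) ≋ + j ⟨mod z ⟩ ⇔ z ∣ d
index-difference {z} j d =
  mk⇔ (λ (mod-dvd z∣diff) → ℤˢ.∣⇒∣ᵤ (subst (+ z ℤˢ.∣_) (difference (+ j) (+ d)) z∣diff))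
      (λ z∣d → mod-intro (+ d) (ℤˢ.∣ᵤ⇒∣ z∣d) (difference (+ j) (+ d)))
  where
  difference : ∀ j d → (j + d) - j ≡ d
  difference = solve-∀

Q : ℤ → ℤ → ℤ → ℤ
Q a x u = x * x - a * x * u + u * u

Q-sym : ∀ a x u → Q a x u ≡ Q a u x
Q-sym = swap
  where
  swap : ∀ a x u → x * x - a * x * u + u * u ≡ u * u - a * u * x + x * x
  swap = solve-∀

-- Two pairs with the same Q-value: x ≡ y (mod p^b) follows from u ≡ v (mod p^b)
-- provided p ∤ x + y − a·v, because
-- (x − y)(x + y − a·v) = Q_a(x,u) − Q_a(y,v) + (u − v)(a·x − u − v).
pair-cancel : ∀ {p a x u y v} → Prime p → Q a x u ≡ Q a y v → ∀ b →
              u ≋ v ⟨mod p ^ b ⟩ → ¬ (+ p ∣ℤ (x + y - a * v)) → x ≋ y ⟨mod p ^ b ⟩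
pair-cancel {p} {a} {x} {u} {y} {v} p-prime same b (mod-dvd m∣u-v) p∤w =
  to ≡[mod]⇔≋ (prime-power-cancelℤ {w = x + y - a * v} {c = x - y} p-prime p∤w b (ℤˢ.∣⇒∣ᵤ m∣product))
  where
  open ≡-Reasoning
  factorisation : ∀ a x u y v → (x - y) * (x + y - a * v)
                  ≡ ((x * x - a * x * u + u * u) - (y * y - a * y * v + v * v)) + (u - v) * (a * x - u - v)
  factorisation = solve-∀
  product≡ : (x - y) * (x + y - a * v) ≡ (u - v) * (a * x - u - v)
  product≡ = begin
    (x - y) * (x + y - a * v)                         ≡⟨ factorisation a x u y v ⟩
    (Q a x u - Q a y v) + (u - v) * (a * x - u - v)   ≡⟨ cong (λ t → (t - Q a y v) + (u - v) * (a * x - u - v)) same ⟩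
    (Q a y v - Q a y v) + (u - v) * (a * x - u - v)   ≡⟨ cong (_+ (u - v) * (a * x - u - v)) (ℤP.+-inverseʳ (Q a y v)) ⟩
    + 0 + (u - v) * (a * x - u - v)                   ≡⟨ ℤP.+-identityˡ _ ⟩
    (u - v) * (a * x - u - v)                         ∎
  m∣product : + (p ^ b) ℤˢ.∣ ((x - y) * (x + y - a * v))
  m∣product = subst (+ (p ^ b) ℤˢ.∣_) (sym product≡) (ℤˢ.∣m⇒∣m*n _ m∣u-v)

coefficient : ℕ → ℤ
coefficient k = + (4 ℕ.* k ℕ.+ 2)

cassini : ∀ k n → Q (coefficient k) (U k (suc n)) (U k n) ≡ + 1
cassini k zero = initial (coefficient k)
  where
  initial : ∀ a → + 1 * + 1 - a * + 1 * + 0 + + 0 * + 0 ≡ + 1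
  initial = solve-∀
cassini k (suc n) = trans (invariant (coefficient k) (U k (suc n)) (U k n)) (cassini k n)
  where
  invariant : ∀ a x y → (a * x - y) * (a * x - y) - a * (a * x - y) * x + x * x
                        ≡ x * x - a * x * y + y * y
  invariant = solve-∀

module _ {k p : ℕ} (p∣k : p ∣ k) where

  coefficient≋2 : coefficient k ≋ + 2 ⟨mod p ⟩
  coefficient≋2 = mod-intro (+ (4 ℕ.* k)) (ℤˢ.∣ᵤ⇒∣ (ℕD.∣-trans p∣k (ℕD.n∣m*n 4))) (cancel (+ (4 ℕ.* k)))
    where
    cancel : ∀ x → (x + + 2) - + 2 ≡ x
    cancel = solve-∀

  -- hence modulo p the recurrence is U_{n+2} ≡ 2U_{n+1} − U_n, solved by U_n ≡ n
  U≋index : ∀ n → U k n ≋ + n ⟨mod p ⟩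
  U≋index zero = mod-refl
  U≋index (suc zero) = mod-refl
  U≋index (suc (suc n)) = begin
    coefficient k * U k (suc n) - U k n  ≈⟨ mod-- (mod-* coefficient≋2 (U≋index (suc n))) (U≋index n) ⟩
    + 2 * (+ 1 + + n) - + n             ≡⟨ linear (+ n) ⟩
    + 2 + + n                           ∎
    where
    open ModReasoning p
    linear : ∀ n → + 2 * (+ 1 + n) - n ≡ + 2 + n
    linear = solve-∀

p∣pᵇ : ∀ {p b} → 1 ≤ b → p ∣ p ^ b
p∣pᵇ {p} {suc b} _ = ℕD.m∣m*n (p ^ b)

module OddPrimeDivisor {k p : ℕ} (p-prime : Prime p) (p-odd : ¬ 2 ∣ p) (p∣k : p ∣ k)
                       {b : ℕ} (b≥1 : 1 ≤ b) where

  m : ℕ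
  m = p ^ b

  -- terms congruent modulo p^b have indices congruent modulo p, as U_n ≡ n (mod p)
  index-congruence : ∀ i j → U k i ≋ U k j ⟨mod m ⟩ → + i ≋ + j ⟨mod p ⟩
  index-congruence i j Uᵢ≋Uⱼ =
    mod-trans (mod-sym (U≋index p∣k i)) (mod-trans (mod-weaken (p∣pᵇ b≥1) Uᵢ≋Uⱼ) (U≋index p∣k j))

  p∤2 : ¬ (+ p ∣ℤ + 2)
  p∤2 = odd-prime∤2 p-prime p-odd

  -- U_i ≡ U_j ⇒ U_{i+1} ≡ U_{j+1}: pair-cancel for (U_{i+1}, U_i), (U_{j+1}, U_j),
  -- where U_{i+1} + U_{j+1} − A·U_j ≡ (i + 1) + (j + 1) − 2j ≡ 2 (mod p)
  step-forward : ∀ i j → U k i ≋ U k j ⟨mod m ⟩ → U k (suc i) ≋ U k (suc j) ⟨mod m ⟩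
  step-forward i j Uᵢ≋Uⱼ =
    pair-cancel {a = coefficient k} p-prime (trans (cassini k i) (sym (cassini k j))) b Uᵢ≋Uⱼ (mod-not-dvd w≋2 p∤2)
    where
    open ModReasoning p
    regroup : ∀ i j → (+ 1 + i) + (+ 1 + j) - + 2 * j ≡ i + (+ 2 - j)
    regroup = solve-∀
    cancel : ∀ j → j + (+ 2 - j) ≡ + 2
    cancel = solve-∀
    w≋2 : U k (suc i) + U k (suc j) - coefficient k * U k j ≋ + 2 ⟨mod p ⟩
    w≋2 = begin
      U k (suc i) + U k (suc j) - coefficient k * U k j
        ≈⟨ mod-- (mod-+ (U≋index p∣k (suc i)) (U≋index p∣k (suc j)))
                 (mod-* (coefficient≋2 p∣k) (U≋index p∣k j)) ⟩
      (+ 1 + + i) + (+ 1 + + j) - + 2 * + j  ≡⟨ regroup (+ i) (+ j) ⟩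
      + i + (+ 2 - + j)                      ≈⟨ mod-+ (index-congruence i j Uᵢ≋Uⱼ) (mod-refl {a = + 2 - + j}) ⟩
      + j + (+ 2 - + j)                      ≡⟨ cancel (+ j) ⟩
      + 2                                    ∎

  -- U_{i+1} ≡ U_{j+1} ⇒ U_i ≡ U_j: pair-cancel for (U_i, U_{i+1}), (U_j, U_{j+1}),
  -- where U_i + U_j − A·U_{j+1} ≡ i + j − 2(j + 1) ≡ −2 (mod p)
  step-backward : ∀ i j → U k (suc i) ≋ U k (suc j) ⟨mod m ⟩ → U k i ≋ U k j ⟨mod m ⟩
  step-backward i j Uᵢ₊₁≋Uⱼ₊₁ = pair-cancel {a = A} p-prime same-value b Uᵢ₊₁≋Uⱼ₊₁ (mod-not-dvd w≋-2 p∤2)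
    where
    open ModReasoning p
    A : ℤ
    A = coefficient k
    same-value : Q A (U k i) (U k (suc i)) ≡ Q A (U k j) (U k (suc j))
    same-value = trans (Q-sym A (U k i) (U k (suc i)))
                   (trans (cassini k i) (sym (trans (Q-sym A (U k j) (U k (suc j))) (cassini k j))))
    regroup : ∀ i j → i + j - + 2 * (+ 1 + j) ≡ (+ 1 + i) - (+ 3 + j)
    regroup = solve-∀
    cancel : ∀ j → (+ 1 + j) - (+ 3 + j) ≡ - + 2
    cancel = solve-∀
    w≋-2 : U k i + U k j - A * U k (suc j) ≋ - + 2 ⟨mod p ⟩
    w≋-2 = begin
      U k i + U k j - A * U k (suc j)
        ≈⟨ mod-- (mod-+ (U≋index p∣k i) (U≋index p∣k j))
                 (mod-* (coefficient≋2 p∣k) (U≋index p∣k (suc j))) ⟩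
      + i + + j - + 2 * (+ 1 + + j)          ≡⟨ regroup (+ i) (+ j) ⟩
      (+ 1 + + i) - (+ 3 + + j)              ≈⟨ mod-- (index-congruence (suc i) (suc j) Uᵢ₊₁≋Uⱼ₊₁) (mod-refl {a = + 3 + + j}) ⟩
      (+ 1 + + j) - (+ 3 + + j)              ≡⟨ cancel (+ j) ⟩
      - + 2                                  ∎

  shift-invariance : ∀ t i j → U k (t ℕ.+ i) ≋ U k (t ℕ.+ j) ⟨mod m ⟩ ⇔ U k i ≋ U k j ⟨mod m ⟩
  shift-invariance zero i j = ⇔.refl
  shift-invariance (suc t) i j =
    mk⇔ (to (shift-invariance t i j) ∘ step-backward (t ℕ.+ i) (t ℕ.+ j))
        (step-forward (t ℕ.+ i) (t ℕ.+ j) ∘ from (shift-invariance t i j))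

  ZeroSet : ℕ → Set
  ZeroSet d = + m ∣ℤ U k d

  -- U_{j+d} ≡ U_j (mod m) exactly when d is in the zero set (shift j down to U_0 = 0)
  window : ∀ j d → U k (j ℕ.+ d) ≋ U k j ⟨mod m ⟩ ⇔ ZeroSet d
  window j d = ⇔.trans
    (subst (λ n → (U k (j ℕ.+ d) ≋ U k n ⟨mod m ⟩) ⇔ (U k d ≋ + 0 ⟨mod m ⟩))
           (ℕP.+-identityʳ j) (shift-invariance j d 0))
    (⇔.sym ∣⇔≋0)

  zero-set-shift : ∀ d e → ZeroSet d → ZeroSet (d ℕ.+ e) ⇔ ZeroSet e
  zero-set-shift d e Zd =
    ⇔.trans ∣⇔≋0 (⇔.trans (mod-retarget (mod-sym (to ∣⇔≋0 Zd))) (window d e))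

  positive-zero : ∃ λ d → 1 ≤ d × ZeroSet d
  positive-zero with pigeonhole-mod m {{ℕP.m^n≢0 p b {{prime⇒nonZero p-prime}}}} (U k)
  ... | i , j , i<j , Uᵢ≋Uⱼ = j ∸ i , ℕP.m<n⇒0<n∸m i<j , to (window i (j ∸ i)) Uⱼ≋Uᵢ
    where
    Uⱼ≋Uᵢ : U k (i ℕ.+ (j ∸ i)) ≋ U k i ⟨mod m ⟩
    Uⱼ≋Uᵢ = subst (λ n → U k n ≋ U k i ⟨mod m ⟩) (sym (ℕP.m+[n∸m]≡n (ℕP.<⇒≤ i<j))) (mod-sym Uᵢ≋Uⱼ)

  rank : Σ ℕ (IsLeastPositive ZeroSet)
  rank = least-positive zero-set? positive-zero
    where
    zero-set? : Decidable ZeroSet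
    zero-set? d = m ℕD.∣? ∣ U k d ∣

  period : ∀ {z} → IsLeastPositive ZeroSet z → ∀ i j → U k i ≋ U k j ⟨mod m ⟩ ⇔ + i ≋ + j ⟨mod z ⟩
  period z-least = compare-by-difference mod-sym mod-sym λ j d →
    ⇔.trans (window j d) (⇔.trans (multiples-of-least zero-set-shift z-least d) (⇔.sym (index-difference j d)))

lemma15 : (k p b : ℕ) → 1 ≤ k → Prime p → ¬ (2 ∣ p) → p ∣ k → 1 ≤ b →
    Σ ℕ (λ z → IsZ k (p ^ b) z ×
    ((i j : ℕ) → (U k i ≡ U k j [mod p ^ b ]) ⇔ ((+ i) ≡ (+ j) [mod z ])))
lemma15 k p b _ p-prime p-odd p∣k b≥1 =
  z , z-least , λ i j → ⇔.trans ≡[mod]⇔≋ (⇔.trans (period z-least i j) (⇔.sym ≡[mod]⇔≋))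
  where
  open OddPrimeDivisor p-prime p-odd p∣k b≥1
  z : ℕ
  z = proj₁ rank
  z-least : IsLeastPositive ZeroSet z
  z-least = proj₂ rank
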